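{- Let $x^*$ be an optimal assignment of a MIN-2CSP instance that is rigid with constant $\delta>0$ (with respect to $x^*$), and let $\mathrm{OPT}=\mathrm{Obj}(x^*)$. For every $c>0$, the number of variables $v$ that are not $(\delta c/3)$-clear and whose cluster $\{u\in V:x^*_u=x^*_v\}$ has size at least $c$ is at most $\frac{6\,\mathrm{OPT}}{\delta c}$.
   Context: A MIN-2CSP instance: a finite set $V$ of variables with values in a finite domain $D$, and nonnegative costs $p_{u,v}(i,j)$ for distinct $u,v\in V$ and $i,j\in D$, symmetric in the sense $p_{u,v}(i,j)=p_{v,u}(j,i)$; for $x\in D^V$, $\mathrm{Obj}(x)=\sum_{\{u,v\}\subseteq V,\,u\ne v}p_{u,v}(x_u,x_v)$, to be minimized. Define $b(x,v,i)=\sum_{u\in V,u\ne v}p_{u,v}(x_u,i)$. The instance is rigid (with constant $\delta>0$, with respect to the optimal assignment $x^*$) if for all $v\in V$ and all $j\ne x^*_v$: $b(x^*,v,x^*_v)+b(x^*,v,j)\ge\delta\,|\{u\in V:x^*_u=x^*_v\}|$. The cluster of $v$ is $\{u\in V:x^*_u=x^*_v\}$. For $m\ge0$, a variable $v$ is $m$-clear if $b(x^*,v,x^*_v)<b(x^*,v,j)-m$ for all $j\ne x^*_v$.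
   Formalization: The costs $p_{u,v}(i,j)$, the rigidity constant $\delta$ and the threshold $c$ are rational. -}

module Defs where

open import Data.Nat as ℕ using (ℕ; zero; suc)
open import Data.Fin using (Fin; zero; suc; toℕ; _≟_)
open import Data.Fin.Properties using (all?)
open import Data.Bool using (Bool; true; false; if_then_else_)
open import Data.List using (List; length; filter; allFin)
open import Data.Rational using (ℚ; 0ℚ; _+_; _*_; _-_; _<_; _≤_; _<?_; _÷_; positive)
open import Data.Rational.Properties using (pos⇒nonZero; pos*pos⇒pos)
open import Relation.Nullary using (¬_; does; Dec)
open import Relation.Nullary.Decidable using (¬?; _→-dec_)
open import Relation.Binary.PropositionalEquality using (_≡_; _≢_)
import Data.Nat as N
open import Data.Integer using (+_)

ℕ→ℚ : ℕ → ℚ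
ℕ→ℚ m = (+ m) Data.Rational./ 1

Σ : (n : ℕ) → (Fin n → ℚ) → ℚ
Σ zero    f = 0ℚ
Σ (suc n) f = f zero + Σ n (λ i → f (suc i))

-- A MIN-2CSP instance: variables V = Fin n, domain D = Fin k,
-- cost p u v i j = p_{u,v}(i,j) (only used for u ≠ v).
record Instance (n k : ℕ) : Set where
  field
    p      : Fin n → Fin n → Fin k → Fin k → ℚ
    nonneg : ∀ u v i j → u ≢ v → 0ℚ ≤ p u v i j
    symm   : ∀ u v i j → u ≢ v → p u v i j ≡ p v u j i

module _ {n k : ℕ} (I : Instance n k) where
  open Instance I

  Assignment : Set
  Assignment = Fin n → Fin k

  -- Obj(x) = sum over unordered pairs {u,v}, u ≠ v (enumerated as toℕ u < toℕ v)
  Obj : Assignment → ℚ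
  Obj x = Σ n (λ u → Σ n (λ v →
            if toℕ u N.<ᵇ toℕ v then p u v (x u) (x v) else 0ℚ))

  b : Assignment → Fin n → Fin k → ℚ
  b x v i = Σ n (λ u → if does (u ≟ v) then 0ℚ else p u v (x u) i)

  Optimal : Assignment → Set
  Optimal x = ∀ y → Obj x ≤ Obj y

  clusterSize : Assignment → Fin n → ℕ
  clusterSize x v = length (filter (λ u → x u ≟ x v) (allFin n))

  Rigid : ℚ → Assignment → Set
  Rigid δ x = ∀ v j → j ≢ x v →
    δ * (ℕ→ℚ (clusterSize x v)) ≤ b x v (x v) + b x v j

  Clear : ℚ → Assignment → Fin n → Set
  Clear m x v = ∀ j → j ≢ x v → b x v (x v) < b x v j - m

  clear? : ∀ m x v → Dec (Clear m x v)
  clear? m x v = all? (λ j → ¬? (j ≟ x v) →-dec (b x v (x v) <? b x v j - m))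

  Bad : ℚ → ℚ → Assignment → Fin n → Set
  Bad m c x v = ¬ Clear m x v × (c ≤ ℕ→ℚ (clusterSize x v))
    where open import Data.Product using (_×_)

  bad? : ∀ m c x v → Dec (Bad m c x v)
  bad? m c x v = ¬? (clear? m x v) ×-dec (c Data.Rational.≤? (ℕ→ℚ (clusterSize x v)))
    where open import Relation.Nullary.Decidable using (_×-dec_)

  countBad : ℚ → ℚ → Assignment → ℕ
  countBad m c x = length (filter (bad? m c x) (allFin n))

bound : (OPT δ c : ℚ) → 0ℚ < δ → 0ℚ < c → ℚ
bound OPT δ c 0<δ 0<c =
  _÷_ (ℕ→ℚ 6 * OPT) (δ * c)
    {{pos⇒nonZero (δ * c) {{pos*pos⇒pos δ {{positive 0<δ}} c {{positive 0<c}}}}}}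

-- Summing b(x*, v, x*_v) over all v counts every pair twice, so it equals 2·OPT.
-- For a variable v that is not m-clear (m = δc/3) there is j ≠ x*_v with
-- b(x*,v,j) ≤ b(x*,v,x*_v) + m; combined with rigidity and a cluster of size ≥ c
-- this gives δc ≤ 2·b(x*,v,x*_v) + m, i.e. b(x*,v,x*_v) ≥ δc/3.  Hence
-- (#bad)·δc/3 ≤ 2·OPT.
module Submission where

open import Defs
open import Data.Nat using (ℕ)
open import Data.Rational using (ℚ; 0ℚ; _*_; _≤_; _<_; _÷_)

import Data.Nat as ℕ
import Data.Nat.Properties as ℕ
open import Data.Fin using (Fin; zero; suc; toℕ; _≟_)
open import Data.Fin.Properties using (toℕ-injective; ¬∀⟶∃¬)
open import Data.Bool using (if_then_else_)
open import Data.List using (length; filter; tabulate)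
open import Data.Rational using (_/_; 1ℚ; _+_; _-_; -_; 1/_; _<?_; NonZero; Positive; positive; nonNegative)
open import Data.Rational.Properties hiding (_≟_)
open import Data.Rational.Solver using (module +-*-Solver)
import Data.Integer as ℤ
import Data.Integer.Properties as ℤ
import Data.Nat.Coprimality as Coprime
open import Data.Product using (_,_; _×_; ∃)
open import Data.Empty using (⊥-elim)
open import Relation.Nullary using (¬_; does; yes; no)
open import Relation.Nullary.Reflects using (ofʸ; ofⁿ)
open import Relation.Nullary.Decidable using (¬?; _→-dec_)
open import Relation.Unary using (Decidable)
open import Relation.Binary.PropositionalEquality

open +-*-Solver using (solve; _:+_; _:*_; _:-_; _:=_; con)

ℕ→ℚ-suc : ∀ m → ℕ→ℚ (ℕ.suc m) ≡ 1ℚ + ℕ→ℚ m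
ℕ→ℚ-suc m
  rewrite normalize-coprime {m} (Coprime.sym (Coprime.1-coprimeTo m))
  = cong (_/ 1) (sym (cong₂ ℤ._+_ (ℤ.*-identityʳ (ℤ.+ 1)) (ℤ.*-identityʳ (ℤ.+ m))))

≤⇒0≤- : ∀ {p q} → p ≤ q → 0ℚ ≤ q - p
≤⇒0≤- {p} {q} p≤q = subst (_≤ q - p) (+-inverseʳ p) (+-monoˡ-≤ (- p) p≤q)

0≤-⇒≤ : ∀ {p q} → 0ℚ ≤ q - p → p ≤ q
0≤-⇒≤ {p} {q} 0≤q-p = subst₂ _≤_ (+-identityˡ p) q-p+p≡q (+-monoˡ-≤ p 0≤q-p)
  where
  q-p+p≡q : q - p + p ≡ q
  q-p+p≡q = solve 2 (λ q p → q :- p :+ p := q) refl q p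

*-nonNeg : ∀ {p q} → 0ℚ ≤ p → 0ℚ ≤ q → 0ℚ ≤ p * q
*-nonNeg {p} {q} 0≤p 0≤q =
  nonNegative⁻¹ (p * q) {{nonNeg*nonNeg⇒nonNeg p {{nonNegative 0≤p}} q {{nonNegative 0≤q}}}}

-- B − m is half the sum of the three nonnegative slacks.
≤-from-rigidity : ∀ {δ c s B B′} → 0ℚ ≤ δ → c ≤ s →
  δ * s ≤ B + B′ → B′ - δ * c ÷ ℕ→ℚ 3 ≤ B → δ * c ÷ ℕ→ℚ 3 ≤ B
≤-from-rigidity {δ} {c} {s} {B} {B′} 0≤δ c≤s rigid unclear =
  0≤-⇒≤ (subst (0ℚ ≤_) half-slack≡ (*-nonNeg {1/ ℕ→ℚ 2} (≤ᵇ⇒≤ _) slack-nonNeg))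
  where
  m = δ * c ÷ ℕ→ℚ 3
  slack-nonNeg : 0ℚ ≤ (B + B′ - δ * s) + (B - (B′ - m)) + δ * (s - c)
  slack-nonNeg = +-mono-≤ (+-mono-≤ (≤⇒0≤- rigid) (≤⇒0≤- unclear)) (*-nonNeg 0≤δ (≤⇒0≤- c≤s))
  half-slack≡ : 1/ ℕ→ℚ 2 * ((B + B′ - δ * s) + (B - (B′ - m)) + δ * (s - c)) ≡ B - m
  half-slack≡ = solve 5 (λ B B′ s δ c →
      con (1/ ℕ→ℚ 2) :* ((B :+ B′ :- δ :* s) :+ (B :- (B′ :- δ :* c :* con (1/ ℕ→ℚ 3))) :+ δ :* (s :- c))
      := B :- δ :* c :* con (1/ ℕ→ℚ 3)) refl B B′ s δ c

≤-÷-from-*≤ : ∀ (N O D : ℚ) .{{_ : Positive D}} → N * (D ÷ ℕ→ℚ 3) ≤ O + O →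
  N ≤ _÷_ (ℕ→ℚ 6 * O) D {{pos⇒nonZero D}}
≤-÷-from-*≤ N O D N*m≤2O = begin
  N                                 ≡⟨ N≡N*m*3/D ⟩
  N * (D ÷ ℕ→ℚ 3) * (ℕ→ℚ 3 * 1/ D) ≤⟨ *-monoʳ-≤-nonNeg (ℕ→ℚ 3 * 1/ D) {{nonNegative 0≤3/D}} N*m≤2O ⟩
  (O + O) * (ℕ→ℚ 3 * 1/ D)          ≡⟨ solve 2 (λ O e → (O :+ O) :* (con (ℕ→ℚ 3) :* e) := con (ℕ→ℚ 6) :* O :* e) refl O (1/ D) ⟩
  ℕ→ℚ 6 * O * 1/ D                  ∎
  where
  open ≤-Reasoning
  instance
    D≢0 : NonZero D
    D≢0 = pos⇒nonZero D
  0≤3/D : 0ℚ ≤ ℕ→ℚ 3 * 1/ D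
  0≤3/D = *-nonNeg {ℕ→ℚ 3} (≤ᵇ⇒≤ _) (<⇒≤ (positive⁻¹ (1/ D) {{1/pos⇒pos D}}))
  N≡N*m*3/D : N ≡ N * (D ÷ ℕ→ℚ 3) * (ℕ→ℚ 3 * 1/ D)
  N≡N*m*3/D = sym (begin-equality
    N * (D ÷ ℕ→ℚ 3) * (ℕ→ℚ 3 * 1/ D)
      ≡⟨ solve 3 (λ N D e → N :* (D :* con (1/ ℕ→ℚ 3)) :* (con (ℕ→ℚ 3) :* e) := N :* (D :* e)) refl N D (1/ D) ⟩
    N * (D * 1/ D) ≡⟨ cong (N *_) (*-inverseʳ D) ⟩
    N * 1ℚ         ≡⟨ *-identityʳ N ⟩
    N              ∎)

Σ-cong : ∀ n {f g : Fin n → ℚ} → (∀ i → f i ≡ g i) → Σ n f ≡ Σ n g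
Σ-cong ℕ.zero    f≡g = refl
Σ-cong (ℕ.suc n) f≡g = cong₂ _+_ (f≡g zero) (Σ-cong n (λ i → f≡g (suc i)))

Σ-zero : ∀ n → Σ n (λ _ → 0ℚ) ≡ 0ℚ
Σ-zero ℕ.zero    = refl
Σ-zero (ℕ.suc n) = cong (0ℚ +_) (Σ-zero n)

Σ-distrib-+ : ∀ n (f g : Fin n → ℚ) → Σ n (λ i → f i + g i) ≡ Σ n f + Σ n g
Σ-distrib-+ ℕ.zero    f g = refl
Σ-distrib-+ (ℕ.suc n) f g = begin
  f zero + g zero + Σ n (λ i → f (suc i) + g (suc i))
    ≡⟨ cong (f zero + g zero +_) (Σ-distrib-+ n (f ∘suc) (g ∘suc)) ⟩
  f zero + g zero + (Σ n (f ∘suc) + Σ n (g ∘suc))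
    ≡⟨ solve 4 (λ a b c d → (a :+ b) :+ (c :+ d) := (a :+ c) :+ (b :+ d)) refl
         (f zero) (g zero) (Σ n (f ∘suc)) (Σ n (g ∘suc)) ⟩
  f zero + Σ n (f ∘suc) + (g zero + Σ n (g ∘suc)) ∎
  where
  open ≡-Reasoning
  _∘suc : ∀ {n} → (Fin (ℕ.suc n) → ℚ) → Fin n → ℚ
  h ∘suc = λ i → h (suc i)

Σ-comm : ∀ n m (f : Fin n → Fin m → ℚ) →
  Σ n (λ u → Σ m (f u)) ≡ Σ m (λ v → Σ n (λ u → f u v))
Σ-comm ℕ.zero    m f = sym (Σ-zero m)
Σ-comm (ℕ.suc n) m f = trans (cong (Σ m (f zero) +_) (Σ-comm n m (λ u → f (suc u))))
  (sym (Σ-distrib-+ m (f zero) (λ v → Σ n (λ u → f (suc u) v))))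

Σ-nonNeg : ∀ n (f : Fin n → ℚ) → (∀ i → 0ℚ ≤ f i) → 0ℚ ≤ Σ n f
Σ-nonNeg ℕ.zero    f 0≤f = ≤-refl
Σ-nonNeg (ℕ.suc n) f 0≤f = +-mono-≤ (0≤f zero) (Σ-nonNeg n (λ i → f (suc i)) (λ i → 0≤f (suc i)))

length-filter*≤Σ : ∀ {M} n (f : Fin n → Fin M) {P : Fin M → Set} (P? : Decidable P)
  (h : Fin M → ℚ) (t : ℚ) → (∀ a → P a → t ≤ h a) → (∀ a → 0ℚ ≤ h a) →
  ℕ→ℚ (length (filter P? (tabulate f))) * t ≤ Σ n (λ i → h (f i))
length-filter*≤Σ ℕ.zero f P? h t t≤h 0≤h = ≤-reflexive (*-zeroˡ t)
length-filter*≤Σ (ℕ.suc n) f P? h t t≤h 0≤h with P? (f zero)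
... | yes Pf₀ = subst (_≤ h (f zero) + Σ n (λ i → h (f (suc i)))) (sym count-suc*t)
                  (+-mono-≤ (t≤h _ Pf₀) rest)
  where
  L = length (filter P? (tabulate (λ i → f (suc i))))
  rest = length-filter*≤Σ n (λ i → f (suc i)) P? h t t≤h 0≤h
  count-suc*t : ℕ→ℚ (ℕ.suc L) * t ≡ t + ℕ→ℚ L * t
  count-suc*t = trans (cong (_* t) (ℕ→ℚ-suc L))
                  (trans (*-distribʳ-+ t 1ℚ (ℕ→ℚ L)) (cong (_+ ℕ→ℚ L * t) (*-identityˡ t)))
... | no _ = subst (_≤ h (f zero) + Σ n (λ i → h (f (suc i)))) (+-identityˡ _)
               (+-mono-≤ (0≤h (f zero)) (length-filter*≤Σ n (λ i → f (suc i)) P? h t t≤h 0≤h))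

module _ {n k : ℕ} (I : Instance n k) (x : Assignment I) where
  open Instance I

  private
    pairCost : Fin n → Fin n → ℚ
    pairCost u v = if toℕ u ℕ.<ᵇ toℕ v then p u v (x u) (x v) else 0ℚ

    edgeCost : Fin n → Fin n → ℚ
    edgeCost u v = if does (u ≟ v) then 0ℚ else p u v (x u) (x v)

    edgeCost≡pairCost+pairCost : ∀ u v → edgeCost u v ≡ pairCost u v + pairCost v u
    edgeCost≡pairCost+pairCost u v
      with u ≟ v | toℕ u ℕ.<ᵇ toℕ v | ℕ.<ᵇ-reflects-< (toℕ u) (toℕ v)
                 | toℕ v ℕ.<ᵇ toℕ u | ℕ.<ᵇ-reflects-< (toℕ v) (toℕ u)
    ... | yes refl | _ | ofʸ u<u | _ | _      = ⊥-elim (ℕ.<-irrefl refl u<u)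
    ... | yes refl | _ | ofⁿ _   | _ | ofʸ u<u = ⊥-elim (ℕ.<-irrefl refl u<u)
    ... | yes refl | _ | ofⁿ _   | _ | ofⁿ _  = refl
    ... | no _     | _ | ofʸ u<v | _ | ofʸ v<u = ⊥-elim (ℕ.<-asym u<v v<u)
    ... | no _     | _ | ofʸ _   | _ | ofⁿ _  = sym (+-identityʳ _)
    ... | no u≢v   | _ | ofⁿ _   | _ | ofʸ _  = trans (symm u v (x u) (x v) u≢v) (sym (+-identityˡ _))
    ... | no u≢v   | _ | ofⁿ u≮v | _ | ofⁿ v≮u =
      ⊥-elim (u≢v (toℕ-injective (ℕ.≤-antisym (ℕ.≮⇒≥ v≮u) (ℕ.≮⇒≥ u≮v))))

  Σ-b≡Obj+Obj : Σ n (λ v → b I x v (x v)) ≡ Obj I x + Obj I x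
  Σ-b≡Obj+Obj = begin
    Σ n (λ v → Σ n (λ u → edgeCost u v))
      ≡⟨ Σ-cong n (λ v → Σ-cong n (λ u → edgeCost≡pairCost+pairCost u v)) ⟩
    Σ n (λ v → Σ n (λ u → pairCost u v + pairCost v u))
      ≡⟨ Σ-cong n (λ v → Σ-distrib-+ n (λ u → pairCost u v) (pairCost v)) ⟩
    Σ n (λ v → Σ n (λ u → pairCost u v) + Σ n (pairCost v))
      ≡⟨ Σ-distrib-+ n _ _ ⟩
    Σ n (λ v → Σ n (λ u → pairCost u v)) + Obj I x
      ≡⟨ cong (_+ Obj I x) (sym (Σ-comm n n pairCost)) ⟩
    Obj I x + Obj I x ∎
    where open ≡-Reasoning

  b-nonNeg : ∀ v i → 0ℚ ≤ b I x v i
  b-nonNeg v i = Σ-nonNeg n _ term-nonNeg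
    where
    term-nonNeg : ∀ u → 0ℚ ≤ (if does (u ≟ v) then 0ℚ else p u v (x u) i)
    term-nonNeg u with u ≟ v
    ... | yes _  = ≤-refl
    ... | no u≢v = nonneg u v (x u) i u≢v

  ¬Clear⇒∃≤ : ∀ m v → ¬ Clear I m x v → ∃ λ j → j ≢ x v × b I x v j - m ≤ b I x v (x v)
  ¬Clear⇒∃≤ m v ¬clear with ¬∀⟶∃¬ k _ (λ j → ¬? (j ≟ x v) →-dec (b I x v (x v) <? b I x v j - m)) ¬clear
  ... | j , ¬clear-at-j = j , (λ j≡xv → ¬clear-at-j (λ j≢xv → ⊥-elim (j≢xv j≡xv)))
                            , ≮⇒≥ (λ lt → ¬clear-at-j (λ _ → lt))

  Bad⇒δc÷3≤b : ∀ δ c → 0ℚ < δ → Rigid I δ x → ∀ v →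
    Bad I (δ * c ÷ ℕ→ℚ 3) c x v → δ * c ÷ ℕ→ℚ 3 ≤ b I x v (x v)
  Bad⇒δc÷3≤b δ c 0<δ rigid v (¬clear , c≤size) with ¬Clear⇒∃≤ (δ * c ÷ ℕ→ℚ 3) v ¬clear
  ... | j , j≢xv , unclear = ≤-from-rigidity (<⇒≤ 0<δ) c≤size (rigid v j j≢xv) unclear

lemma15 : {n k : ℕ} (I : Instance n k) (xs : Assignment I) (δ : ℚ) (0<δ : 0ℚ < δ)
    → Optimal I xs → Rigid I δ xs
    → (c : ℚ) (0<c : 0ℚ < c)
    → ℕ→ℚ (countBad I (δ * c ÷ ℕ→ℚ 3) c xs) ≤ bound (Obj I xs) δ c 0<δ 0<c
lemma15 {n} I xs δ 0<δ _ rigid c 0<c =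
  ≤-÷-from-*≤ N (Obj I xs) (δ * c) {{pos*pos⇒pos δ {{positive 0<δ}} c {{positive 0<c}}}} N*m≤2OPT
  where
  m = δ * c ÷ ℕ→ℚ 3
  N = ℕ→ℚ (countBad I m c xs)
  N*m≤2OPT : N * m ≤ Obj I xs + Obj I xs
  N*m≤2OPT = subst (N * m ≤_) (Σ-b≡Obj+Obj I xs)
    (length-filter*≤Σ n (λ v → v) (bad? I m c xs) (λ v → b I xs v (xs v)) m
      (Bad⇒δc÷3≤b I xs δ c 0<δ rigid) (λ v → b-nonNeg I xs v (xs v)))
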